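{- Let $T$ be a tournament, $S\subseteq V(T)$ and $k$ an integer, and suppose $s\in S$ lies on no directed triangle of $T$. Then there exists $F\subseteq A(T)$ with $|F|\le k$ such that $T\circledast F$ has no $S$-cycle if and only if there exists $F'\subseteq A(T-s)$ with $|F'|\le k$ such that $(T-s)\circledast F'$ has no $(S\setminus\{s\})$-cycle.
   Context: A tournament is a directed graph with exactly one arc between every pair of distinct vertices. For $X\subseteq V$, an $X$-cycle is a directed cycle containing at least one vertex of $X$. $T-s$ is the tournament obtained by deleting vertex $s$. $D\circledast F$ is the digraph obtained from $D$ by reversing every arc of $F$. -}

module Defs where

open import Data.Nat using (ℕ; suc; _≤_)
open import Data.Fin using (Fin; punchIn)
open import Data.Fin.Subset using (Subset; _∈_)
open import Data.Bool using (Bool; true)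
open import Data.Vec using (tabulate; lookup)
open import Data.List using (List; []; _∷_; _++_; [_]; length)
open import Data.List.Relation.Unary.Any using (Any)
open import Data.List.Relation.Unary.All using (All)
open import Data.List.Relation.Unary.Unique.Propositional using (Unique)
import Data.List.Membership.Propositional as LM
open import Data.Product using (Σ; ∃; ∃-syntax; _×_; _,_)
open import Data.Sum using (_⊎_)
open import Data.Empty using (⊥)
open import Data.Unit using (⊤)
open import Relation.Binary.PropositionalEquality using (_≡_; _≢_)
open import Relation.Nullary using (¬_)
open import Data.Integer using (ℤ; +_) renaming (_≤_ to _≤ℤ_)

Digraph : ℕ → Set₁
Digraph n = Fin n → Fin n → Set

BoolGraph : ℕ → Set
BoolGraph n = Fin n → Fin n → Bool

arcs : ∀ {n} → BoolGraph n → Digraph n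
arcs T u v = T u v ≡ true

record IsTournament {n : ℕ} (T : BoolGraph n) : Set where
  field
    irrefl  : ∀ u → ¬ arcs T u u
    total   : ∀ u v → u ≢ v → arcs T u v ⊎ arcs T v u
    antisym : ∀ u v → arcs T u v → ¬ arcs T v u

Chain : ∀ {n} → Digraph n → List (Fin n) → Set
Chain D []           = ⊤
Chain D (x ∷ [])     = ⊤
Chain D (x ∷ y ∷ zs) = D x y × Chain D (y ∷ zs)

ClosedChain : ∀ {n} → Digraph n → List (Fin n) → Set
ClosedChain D []       = ⊥
ClosedChain D (x ∷ xs) = Chain D (x ∷ xs ++ [ x ])

IsCycle : ∀ {n} → Digraph n → List (Fin n) → Set
IsCycle D vs = 2 ≤ length vs × Unique vs × ClosedChain D vs

HasXCycle : ∀ {n} → Digraph n → Subset n → Set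
HasXCycle D X = ∃[ vs ] (IsCycle D vs × Any (λ v → v ∈ X) vs)

-- F ⊆ A(T), as a duplicate-free list of arcs (so |F| = length F).
ArcSubset : ∀ {n} → Digraph n → List (Fin n × Fin n) → Set
ArcSubset D F = Unique F × All (λ { (u , v) → D u v }) F

-- D ⊛ F : reverse every arc of F.
Reverse : ∀ {n} → Digraph n → List (Fin n × Fin n) → Digraph n
Reverse D F u v = (D u v × ¬ ((u , v) LM.∈ F)) ⊎ (D v u × (v , u) LM.∈ F)

delete : ∀ {n} → BoolGraph (suc n) → Fin (suc n) → BoolGraph n
delete T s u v = T (punchIn s u) (punchIn s v)

deleteSub : ∀ {n} → Subset (suc n) → Fin (suc n) → Subset n
deleteSub S s = tabulate (λ u → lookup S (punchIn s u))

OnTriangle : ∀ {n} → BoolGraph n → Fin n → Set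
OnTriangle T s = ∃[ a ] ∃[ b ] (arcs T s a × arcs T a b × arcs T b s)

Solvable : ∀ {n} → BoolGraph n → Subset n → ℤ → Set
Solvable T S k =
  ∃[ F ] (ArcSubset (arcs T) F × (+ length F) ≤ℤ k × ¬ HasXCycle (Reverse (arcs T) F) S)

-- Deleting s: the arcs of a solution F for T that avoid s form a solution for T − s,
-- because a cycle of (T − s) ⊛ F′ is, via punchIn, a cycle of T ⊛ F.
-- Adding s back: from a solution F′ for T − s keep only the arcs whose ends lie on the
-- same side of N⁺(s). Since s is on no directed triangle, N⁺(s) is closed under the
-- arcs of T ⊛ F, so every cycle lies entirely inside or entirely outside N⁺(s); and it
-- avoids s, since the successor of s would drag s itself into N⁺(s). On such a cycle
-- the reversed arcs are exactly those of F′, so it already is a cycle of (T − s) ⊛ F′.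
module Submission where

open import Defs
open import Data.Bool using (Bool; true; false)
import Data.Bool.Properties as Bool
open import Data.Fin using (Fin; punchIn; punchOut; _≟_)
open import Data.Fin.Properties using (punchIn-injective; punchInᵢ≢i; punchIn-punchOut)
open import Data.Fin.Subset using (Subset; _∈_)
open import Data.Integer using (ℤ; +≤+)
import Data.Integer.Properties as ℤ
open import Data.List using (List; []; _∷_; _++_; [_]; length; map; filter; mapMaybe)
open import Data.List.Properties using (map-++; length-map; length-filter; length-mapMaybe)
open import Data.List.Membership.Propositional using () renaming (_∈_ to _∈ˡ_)
open import Data.List.Membership.Propositional.Properties using (∈-map∘filter⁻; ∈-map∘filter⁺)
open import Data.List.Relation.Unary.All using (All; []; _∷_)
import Data.List.Relation.Unary.All as All
import Data.List.Relation.Unary.All.Properties as All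
open import Data.List.Relation.Unary.AllPairs using ([]; _∷_)
open import Data.List.Relation.Unary.Any using (Any; here; there; any?)
import Data.List.Relation.Unary.Any as Any
import Data.List.Relation.Unary.Any.Properties as Any
open import Data.List.Relation.Unary.Unique.Propositional using (Unique)
import Data.List.Relation.Unary.Unique.Propositional.Properties as Unique
open import Data.Maybe using (Maybe; just; nothing)
open import Data.Nat using (ℕ; suc) renaming (_≤_ to _≤ℕ_)
open import Data.Product using (_×_; _,_; ∃-syntax; proj₁; proj₂)
import Data.Product as Product
open import Data.Sum using (inj₁; inj₂)
open import Data.Unit using (tt)
open import Data.Vec using (lookup)
open import Data.Vec.Properties using (lookup∘tabulate; []=⇒lookup; lookup⇒[]=)
open import Function using (_∘_)
open import Relation.Binary.Core using (_Preserves_⟶_)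
open import Relation.Binary.Definitions using (_Respects_)
open import Relation.Binary.PropositionalEquality using (_≡_; _≢_; refl; sym; trans; cong; cong₂; subst)
open import Relation.Nullary using (¬_; Dec; yes; no; contradiction)

module _ {a b} {A : Set a} {B : Set b} (f : A → Maybe B) where

  ∈-mapMaybe⁻ : ∀ {xs y} → y ∈ˡ mapMaybe f xs → ∃[ x ] x ∈ˡ xs × f x ≡ just y
  ∈-mapMaybe⁻ {x ∷ xs} y∈ with f x in fx | y∈
  ... | just _  | here refl = x , here refl , fx
  ... | just _  | there y∈′ = Product.map₂ (Product.map₁ there) (∈-mapMaybe⁻ y∈′)
  ... | nothing | y∈′       = Product.map₂ (Product.map₁ there) (∈-mapMaybe⁻ y∈′)

  ∈-mapMaybe⁺ : ∀ {xs x y} → x ∈ˡ xs → f x ≡ just y → y ∈ˡ mapMaybe f xs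
  ∈-mapMaybe⁺ (here refl) fx rewrite fx = here refl
  ∈-mapMaybe⁺ {x′ ∷ _} (there x∈) fx with f x′
  ... | just _  = there (∈-mapMaybe⁺ x∈ fx)
  ... | nothing = ∈-mapMaybe⁺ x∈ fx

  Unique-mapMaybe : (∀ {x x′ y} → f x ≡ just y → f x′ ≡ just y → x ≡ x′) →
                    ∀ {xs} → Unique xs → Unique (mapMaybe f xs)
  Unique-mapMaybe inj [] = []
  Unique-mapMaybe inj {x ∷ _} (x∉ ∷ u) with f x in fx
  ... | nothing = Unique-mapMaybe inj u
  ... | just y  = All.tabulate y≢ ∷ Unique-mapMaybe inj u
    where
    y≢ : ∀ {y′} → y′ ∈ˡ _ → y ≢ y′
    y≢ y′∈ refl with x′ , x′∈ , fx′ ← ∈-mapMaybe⁻ y′∈ = All.lookup x∉ x′∈ (inj fx fx′)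

module _ {m n} {D : Digraph m} {E : Digraph n} {f : Fin m → Fin n} where

  Chain-map : f Preserves D ⟶ E → ∀ {ws} → Chain D ws → Chain E (map f ws)
  Chain-map hom {[]}        _        = tt
  Chain-map hom {_ ∷ []}    _        = tt
  Chain-map hom {_ ∷ _ ∷ _} (d , ch) = hom d , Chain-map hom ch

  IsCycle-map : (∀ {u v} → f u ≡ f v → u ≡ v) → f Preserves D ⟶ E →
                ∀ {ws} → IsCycle D ws → IsCycle E (map f ws)
  IsCycle-map inj hom {w ∷ ws} (2≤ , u , ch) =
    subst (2 ≤ℕ_) (sym (length-map f (w ∷ ws))) 2≤ ,
    Unique.map⁺ inj u ,
    subst (Chain E) (map-++ f (w ∷ ws) [ w ]) (Chain-map hom ch)

  HasXCycle-map : (∀ {u v} → f u ≡ f v → u ≡ v) → f Preserves D ⟶ E →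
                  {X : Subset m} {Y : Subset n} → (∀ {u} → u ∈ X → f u ∈ Y) →
                  HasXCycle D X → HasXCycle E Y
  HasXCycle-map inj hom X⇒Y (ws , cyc , hit) =
    map f ws , IsCycle-map inj hom cyc , Any.map⁺ (Any.map X⇒Y hit)

  Chain-map⁻ : {P : Fin m → Set} → (∀ {u v} → P u → P v → E (f u) (f v) → D u v) →
               ∀ {ws} → All P ws → Chain E (map f ws) → Chain D ws
  Chain-map⁻ pull {[]}        _              _        = tt
  Chain-map⁻ pull {_ ∷ []}    _              _        = tt
  Chain-map⁻ pull {_ ∷ _ ∷ _} (pu ∷ pv ∷ ps) (e , ch) = pull pu pv e , Chain-map⁻ pull (pv ∷ ps) ch

  IsCycle-map⁻ : {P : Fin m → Set} → (∀ {u v} → P u → P v → E (f u) (f v) → D u v) →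
                 ∀ {ws} → All P ws → IsCycle E (map f ws) → IsCycle D ws
  IsCycle-map⁻ pull {w ∷ ws} ps (2≤ , u , ch) =
    subst (2 ≤ℕ_) (length-map f (w ∷ ws)) 2≤ ,
    Unique.map⁻ u ,
    Chain-map⁻ pull (All.++⁺ ps (All.head ps ∷ []))
               (subst (Chain E) (sym (map-++ f (w ∷ ws) [ w ])) ch)

module _ {n} {D : Digraph n} {P : Fin n → Set} (closed : P Respects D) where

  Chain-All : ∀ {x xs} → Chain D (x ∷ xs) → P x → All P (x ∷ xs)
  Chain-All {xs = []}    _        px = px ∷ []
  Chain-All {xs = _ ∷ _} (d , ch) px = px ∷ Chain-All ch (closed d px)

  Chain-last : ∀ {x} xs {z} → Chain D (x ∷ xs ++ [ z ]) → Any P (x ∷ xs) → P z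
  Chain-last []       (d , _)  (here px)   = closed d px
  Chain-last (_ ∷ xs) (d , ch) (here px)   = Chain-last xs ch (here (closed d px))
  Chain-last (_ ∷ xs) (_ , ch) (there hit) = Chain-last xs ch hit

  ClosedChain-All : ∀ {vs} → ClosedChain D vs → Any P vs → All P vs
  ClosedChain-All {x ∷ xs} ch hit = All.++⁻ˡ (x ∷ xs) (Chain-All ch (Chain-last xs ch hit))

ClosedChain-monochromatic : ∀ {n} {D : Digraph n} (c : Fin n → Bool) → (λ v → c v ≡ true) Respects D →
                            ∀ {vs} → ClosedChain D vs → ∃[ b ] All (λ v → c v ≡ b) vs
ClosedChain-monochromatic c closed {vs} ch with any? (λ v → c v Bool.≟ true) vs
... | yes hit  = true , ClosedChain-All closed ch hit
... | no  miss = false , All.map Bool.¬-not (All.¬Any⇒All¬ vs miss)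

module _ {n} {D : Digraph n} {Q : Fin n → Set} {s : Fin n} (out : ∀ {y} → D s y → Q y) where

  Chain-successor : ∀ {x} xs {z} → Chain D (x ∷ xs ++ [ z ]) → s ∈ˡ x ∷ xs → Any Q (xs ++ [ z ])
  Chain-successor []       (d , _)  (here refl) = here (out d)
  Chain-successor (_ ∷ _)  (d , _)  (here refl) = here (out d)
  Chain-successor (_ ∷ xs) (_ , ch) (there s∈)  = there (Chain-successor xs ch s∈)

  ClosedChain-successor : ∀ {vs} → ClosedChain D vs → s ∈ˡ vs → Any Q vs
  ClosedChain-successor {x ∷ xs} ch s∈ with Any.++⁻ xs (Chain-successor xs ch s∈)
  ... | inj₁ hit       = there hit
  ... | inj₂ (here q) = here q

Reverse-from : ∀ {n} {D : Digraph n} {F s y} → ¬ (y , s) ∈ˡ F → Reverse D F s y → D s y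
Reverse-from _  (inj₁ (d , _))  = d
Reverse-from ∉F (inj₂ (_ , ∈F)) = contradiction ∈F ∉F

punchIn-preimage : ∀ {n} (s : Fin (suc n)) vs → ¬ s ∈ˡ vs → ∃[ ws ] map (punchIn s) ws ≡ vs
punchIn-preimage s []       _  = [] , refl
punchIn-preimage s (v ∷ vs) s∉ with s ≟ v
... | yes s≡v = contradiction (here s≡v) s∉
... | no  s≢v with ws , eq ← punchIn-preimage s vs (s∉ ∘ there) =
  punchOut s≢v ∷ ws , cong₂ _∷_ (punchIn-punchOut s≢v) eq

Arc : ℕ → Set
Arc n = Fin n × Fin n

module _ {n} (s : Fin (suc n)) where

  punchInArc : Arc n → Arc (suc n)
  punchInArc = Product.map (punchIn s) (punchIn s)

  punchInArc-injective : ∀ {p q} → punchInArc p ≡ punchInArc q → p ≡ q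
  punchInArc-injective eq =
    cong₂ _,_ (punchIn-injective s _ _ (cong proj₁ eq)) (punchIn-injective s _ _ (cong proj₂ eq))

  restrictArc : Arc (suc n) → Maybe (Arc n)
  restrictArc (a , b) with s ≟ a | s ≟ b
  ... | no s≢a | no s≢b = just (punchOut s≢a , punchOut s≢b)
  ... | _      | _      = nothing

  restrictArc-punchInArc : ∀ p → restrictArc (punchInArc p) ≡ just p
  restrictArc-punchInArc (u , v) with s ≟ punchIn s u | s ≟ punchIn s v
  ... | yes s≡ | _      = contradiction (sym s≡) (punchInᵢ≢i s u)
  ... | no _   | yes s≡ = contradiction (sym s≡) (punchInᵢ≢i s v)
  ... | no s≢a | no s≢b = cong just (punchInArc-injective
                            (cong₂ _,_ (punchIn-punchOut s≢a) (punchIn-punchOut s≢b)))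

  punchInArc-restrictArc : ∀ {a p} → restrictArc a ≡ just p → punchInArc p ≡ a
  punchInArc-restrictArc {a , b} eq with s ≟ a | s ≟ b
  punchInArc-restrictArc refl | no s≢a | no s≢b =
    cong₂ _,_ (punchIn-punchOut s≢a) (punchIn-punchOut s≢b)

  restrictArcs : List (Arc (suc n)) → List (Arc n)
  restrictArcs = mapMaybe restrictArc

  ∈-restrictArcs⁺ : ∀ {F p} → punchInArc p ∈ˡ F → p ∈ˡ restrictArcs F
  ∈-restrictArcs⁺ {p = p} p∈ = ∈-mapMaybe⁺ restrictArc p∈ (restrictArc-punchInArc p)

  ∈-restrictArcs⁻ : ∀ {F p} → p ∈ˡ restrictArcs F → punchInArc p ∈ˡ F
  ∈-restrictArcs⁻ p∈ with a , a∈ , eq ← ∈-mapMaybe⁻ restrictArc p∈ =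
    subst (_∈ˡ _) (sym (punchInArc-restrictArc eq)) a∈

  Unique-restrictArcs : ∀ {F} → Unique F → Unique (restrictArcs F)
  Unique-restrictArcs = Unique-mapMaybe restrictArc λ eq eq′ →
    trans (sym (punchInArc-restrictArc eq)) (punchInArc-restrictArc eq′)

  ∈-deleteSub⁺ : ∀ S {u} → punchIn s u ∈ S → u ∈ deleteSub S s
  ∈-deleteSub⁺ S {u} u∈ =
    lookup⇒[]= u _ (trans (lookup∘tabulate (lookup S ∘ punchIn s) u) ([]=⇒lookup u∈))

  ∈-deleteSub⁻ : ∀ S {u} → u ∈ deleteSub S s → punchIn s u ∈ S
  ∈-deleteSub⁻ S {u} u∈ =
    lookup⇒[]= _ S (trans (sym (lookup∘tabulate (lookup S ∘ punchIn s) u)) ([]=⇒lookup u∈))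

module _ {n} (T : BoolGraph (suc n)) (s : Fin (suc n)) where

  Reverse-restrictArcs : ∀ {F} →
    punchIn s Preserves Reverse (arcs (delete T s)) (restrictArcs s F) ⟶ Reverse (arcs T) F
  Reverse-restrictArcs (inj₁ (d , ∉F)) = inj₁ (d , ∉F ∘ ∈-restrictArcs⁺ s)
  Reverse-restrictArcs (inj₂ (d , ∈F)) = inj₂ (d , ∈-restrictArcs⁻ s ∈F)

  Solvable-delete : ∀ S k → Solvable T S k → Solvable (delete T s) (deleteSub S s) k
  Solvable-delete S k (F , (u , F⊆A) , |F|≤k , acyclic) =
    restrictArcs s F ,
    (Unique-restrictArcs s u , All.tabulate (All.lookup F⊆A ∘ ∈-restrictArcs⁻ s)) ,
    ℤ.≤-trans (+≤+ (length-mapMaybe (restrictArc s) F)) |F|≤k ,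
    acyclic ∘ HasXCycle-map (punchIn-injective s _ _) Reverse-restrictArcs (∈-deleteSub⁻ s S)

  SameSide : Arc n → Set
  SameSide (u , v) = T s (punchIn s u) ≡ T s (punchIn s v)

  sameSide? : ∀ p → Dec (SameSide p)
  sameSide? (u , v) = T s (punchIn s u) Bool.≟ T s (punchIn s v)

  liftArcs : List (Arc n) → List (Arc (suc n))
  liftArcs F = map (punchInArc s) (filter sameSide? F)

  ∈-liftArcs⁺ : ∀ {F p} → p ∈ˡ F → SameSide p → punchInArc s p ∈ˡ liftArcs F
  ∈-liftArcs⁺ p∈ side = ∈-map∘filter⁺ (punchInArc s) sameSide? (_ , p∈ , refl , side)

  ∈-liftArcs⁻ : ∀ {F p} → punchInArc s p ∈ˡ liftArcs F → p ∈ˡ F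
  ∈-liftArcs⁻ p∈ with q , q∈ , eq , _ ← ∈-map∘filter⁻ (punchInArc s) sameSide? p∈ =
    subst (_∈ˡ _) (sym (punchInArc-injective s eq)) q∈

  liftArcs-sameSide : ∀ {F x y} → (x , y) ∈ˡ liftArcs F → T s x ≡ T s y
  liftArcs-sameSide {F} xy∈
    with _ , _ , refl , side ← ∈-map∘filter⁻ (punchInArc s) sameSide? {xs = F} xy∈ = side

  liftArcs-avoid : ∀ {F y} → ¬ (y , s) ∈ˡ liftArcs F
  liftArcs-avoid {F} ys∈
    with (_ , v) , _ , eq , _ ← ∈-map∘filter⁻ (punchInArc s) sameSide? {xs = F} ys∈ =
    punchInᵢ≢i s v (sym (cong proj₂ eq))

  Reverse-liftArcs : ∀ {F u v} → SameSide (u , v) →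
                     Reverse (arcs T) (liftArcs F) (punchIn s u) (punchIn s v) →
                     Reverse (arcs (delete T s)) F u v
  Reverse-liftArcs side (inj₁ (d , ∉F)) = inj₁ (d , λ ∈F → ∉F (∈-liftArcs⁺ ∈F side))
  Reverse-liftArcs side (inj₂ (d , ∈F)) = inj₂ (d , ∈-liftArcs⁻ ∈F)

  ArcSubset-liftArcs : ∀ {F} → ArcSubset (arcs (delete T s)) F → ArcSubset (arcs T) (liftArcs F)
  ArcSubset-liftArcs (u , F⊆A) =
    Unique.map⁺ (punchInArc-injective s) (Unique.filter⁺ sameSide? u) ,
    All.map⁺ (All.filter⁺ sameSide? F⊆A)

  length-liftArcs : ∀ F → length (liftArcs F) ≤ℕ length F
  length-liftArcs F rewrite length-map (punchInArc s) (filter sameSide? F) = length-filter sameSide? F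

module _ {n} {T : BoolGraph n} (tournament : IsTournament T) where
  open IsTournament tournament

  arc-flip : ∀ {u v} → u ≢ v → ¬ arcs T u v → arcs T v u
  arc-flip {u} {v} u≢v ¬uv with total u v u≢v
  ... | inj₁ uv = contradiction uv ¬uv
  ... | inj₂ vu = vu

  -- A kept arc x → y leaving N⁺(s) would close the triangle s → x → y → s.
  outNeighbours-closed : ∀ {s F} → ¬ OnTriangle T s → (∀ {x y} → (x , y) ∈ˡ F → T s x ≡ T s y) →
                         arcs T s Respects Reverse (arcs T) F
  outNeighbours-closed _ sameSide (inj₂ (_ , yx∈F)) sx = trans (sameSide yx∈F) sx
  outNeighbours-closed {s} noTriangle _ {x} {y} (inj₁ (xy , _)) sx with T s y Bool.≟ true
  ... | yes sy = sy
  ... | no ¬sy = contradiction (x , y , sx , xy , arc-flip s≢y ¬sy) noTriangle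
    where
    s≢y : s ≢ y
    s≢y refl = antisym x s xy sx

module _ {n} {T : BoolGraph (suc n)} (tournament : IsTournament T)
         (s : Fin (suc n)) (noTriangle : ¬ OnTriangle T s) where
  open IsTournament tournament using (irrefl)

  module _ (F : List (Arc n)) where

    outNeighbours-closed-liftArcs : arcs T s Respects Reverse (arcs T) (liftArcs T s F)
    outNeighbours-closed-liftArcs =
      outNeighbours-closed tournament noTriangle (liftArcs-sameSide T s {F})

    ∉-cycle-liftArcs : ∀ {vs} → IsCycle (Reverse (arcs T) (liftArcs T s F)) vs → ¬ s ∈ˡ vs
    ∉-cycle-liftArcs {vs} (_ , _ , ch) s∈ = irrefl s (All.lookup inside s∈)
      where
      inside : All (arcs T s) vs
      inside = ClosedChain-All outNeighbours-closed-liftArcs ch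
                 (ClosedChain-successor (Reverse-from {D = arcs T} (liftArcs-avoid T s {F})) ch s∈)

    HasXCycle-lower : ∀ {S} → HasXCycle (Reverse (arcs T) (liftArcs T s F)) S →
                      HasXCycle (Reverse (arcs (delete T s)) F) (deleteSub S s)
    HasXCycle-lower {S} (vs , cyc@(_ , _ , ch) , hit)
      with ws , refl ← punchIn-preimage s vs (∉-cycle-liftArcs cyc)
         | b , oneSide ← ClosedChain-monochromatic (T s) outNeighbours-closed-liftArcs {vs} ch =
      ws , IsCycle-map⁻ lower (All.map⁻ oneSide) cyc , Any.map (∈-deleteSub⁺ s S) (Any.map⁻ hit)
      where
      lower : ∀ {u v} → T s (punchIn s u) ≡ b → T s (punchIn s v) ≡ b →
              Reverse (arcs T) (liftArcs T s F) (punchIn s u) (punchIn s v) →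
              Reverse (arcs (delete T s)) F u v
      lower su sv = Reverse-liftArcs T s (trans su (sym sv))

  Solvable-undelete : ∀ S k → Solvable (delete T s) (deleteSub S s) k → Solvable T S k
  Solvable-undelete S k (F , F⊆A , |F|≤k , acyclic) =
    liftArcs T s F , ArcSubset-liftArcs T s F⊆A ,
    ℤ.≤-trans (+≤+ (length-liftArcs T s F)) |F|≤k ,
    acyclic ∘ HasXCycle-lower F

mainTheorem9 : ∀ {n : ℕ} (T : BoolGraph (suc n)) → IsTournament T →
    (S : Subset (suc n)) (k : ℤ) (s : Fin (suc n)) → s ∈ S → ¬ OnTriangle T s →
    (Solvable T S k → Solvable (delete T s) (deleteSub S s) k) ×
    (Solvable (delete T s) (deleteSub S s) k → Solvable T S k)
mainTheorem9 T tournament S k s _ noTriangle =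
  Solvable-delete T s S k , Solvable-undelete tournament s noTriangle S k
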